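{- Consider families of rational numbers $f=(f_n(k))$, $n\ge 1$, $1\le k\le 2n-1$, satisfying the finite difference system $$f_n(k+2)-2f_n(k+1)+f_n(k)+4\,f_{n-1}(k)=0\qquad (n\ge 2,\ 1\le k\le 2n-3). \tag{$*$}$$ Let $(g_n(k))$ be the unique solution of $(*)$ with initial values $f_1(1)=1$ and, for $n\ge 2$, $f_n(1)=0$, $f_n(2)=2\sum_{k}f_{n-1}(k)$. Let $(h_n(k))$ be the unique solution of $(*)$ with initial values $f_1(1)=1$ and, for $n\ge 2$, $f_n(1)=\sum_k f_{n-1}(k)$, $f_n(2)=3\sum_k f_{n-1}(k)$. Then for all $n\ge 1$, $$\sum_{k=1}^{2n-1} g_n(k)=T_{2n-1},\qquad \sum_{k=1}^{2n-1} h_n(k)=E_{2n}.$$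
   Context: Once $f_n(1)$ and $f_n(2)$ are prescribed for each $n\ge2$ (and $f_1(1)$ is given), the system $(*)$ determines all remaining entries $f_n(3),\dots,f_n(2n-1)$ recursively, so the solution is unique. The tangent numbers $T_{2n+1}$ and secant numbers $E_{2n}$ are defined by $\tan u=\sum_{n\ge0}T_{2n+1}u^{2n+1}/(2n+1)!$ and $\sec u=1/\cos u=\sum_{n\ge0}E_{2n}u^{2n}/(2n)!$. -}

module Defs where

open import Data.Nat as ℕ using (ℕ; zero; suc; _∸_)
open import Data.Nat.Combinatorics using (_C_)
open import Data.Integer as ℤ using (ℤ; +_; -_)
open import Data.List using (List; []; _∷_)
open import Data.Rational as ℚ using (ℚ; 0ℚ; _/_)

ℤ→ℚ : ℤ → ℚ
ℤ→ℚ z = z / 1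

neg1^ : ℕ → ℤ
neg1^ zero = + 1
neg1^ (suc k) = - neg1^ k

altSum : ℕ → ℕ → List ℤ → ℤ
altSum N k [] = + 0
altSum N k (e ∷ es) =
  (neg1^ (suc k) ℤ.* (+ (N C (2 ℕ.* k)))) ℤ.* e ℤ.+ altSum N (suc k) es

-- Coefficient identities of formal power series.
-- sec u · cos u = 1 gives, for n ≥ 1,
--   Σ_{k=0}^{n} (-1)^k C(2n,2k) E_{2n-2k} = 0,
-- i.e.  E_{2n} = Σ_{k=1}^{n} (-1)^{k+1} C(2n,2k) E_{2n-2k},  E_0 = 1.
-- secants n = [E_{2n}, E_{2n-2}, …, E_0]
secants : ℕ → List ℤ
secants zero = + 1 ∷ []
secants (suc n) = altSum (2 ℕ.* suc n) 1 (secants n) ∷ secants n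

-- tan u · cos u = sin u gives, for n ≥ 0,
--   Σ_{k=0}^{n} (-1)^k C(2n+1,2k) T_{2n+1-2k} = (-1)^n,
-- i.e.  T_{2n+1} = (-1)^n + Σ_{k=1}^{n} (-1)^{k+1} C(2n+1,2k) T_{2n+1-2k}.
-- tangents n = [T_{2n+1}, T_{2n-1}, …, T_1]
tangents : ℕ → List ℤ
tangents zero = + 1 ∷ []
tangents (suc n) =
  (neg1^ (suc n) ℤ.+ altSum (suc (2 ℕ.* suc n)) 1 (tangents n)) ∷ tangents n

headℤ : List ℤ → ℤ
headℤ [] = + 0
headℤ (x ∷ _) = x

-- Secant number E_{2n}
E : ℕ → ℤ
E n = headℤ (secants n)

-- Tangent number T_{2n+1}
T : ℕ → ℤ
T n = headℤ (tangents n)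

sumFrom1 : ℕ → (ℕ → ℚ) → ℚ
sumFrom1 zero a = 0ℚ
sumFrom1 (suc m) a = sumFrom1 m a ℚ.+ a (suc m)

rowSum : (ℕ → ℕ → ℚ) → ℕ → ℚ
rowSum f n = sumFrom1 (2 ℕ.* n ∸ 1) (f n)

System : (ℕ → ℕ → ℚ) → Set
System f = ∀ n k → 2 ℕ.≤ n → 1 ℕ.≤ k → k ℕ.≤ 2 ℕ.* n ∸ 3 →
  ((f n (k ℕ.+ 2) ℚ.- (+ 2 / 1) ℚ.* f n (k ℕ.+ 1)) ℚ.+ f n k)
    ℚ.+ (+ 4 / 1) ℚ.* f (n ∸ 1) k ≡ 0ℚ
  where open import Relation.Binary.PropositionalEquality using (_≡_)

{-# OPTIONS --safe #-}
module Submission where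

-- Read sequences as exponential generating functions.  By Newton's forward-difference formula a
-- row of a solution of (*) is f_n(t+1) = Σᵢ C(t,i) Δⁱf_n(1), and (*) says Δ²f_n = -4 f_{n-1}.
-- So the differences Δⁱf_n(1) are the initial data f_m(1), f_m(2) - f_m(1) of the earlier rows
-- weighted by powers of -4, and the row sum Σₜ f_n(t+1) = Σᵢ C(2n-1,i+1) Δⁱf_n(1) becomes the
-- coefficient of x^(2n-1)/(2n-1)! in sin x cos x · A + sin² x · B, where
-- A = Σₘ f_{m+1}(1) x^(2m)/(2m)! and B = Σₘ ½(f_{m+2}(2) - f_{m+2}(1)) x^(2m+1)/(2m+1)!.
-- By strong induction on n, the prescribed initial values give A = 1, B = tan for g and
-- A = sec, B = sec′ for h, and the row sums are T_{2n-1} and E_{2n} because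
-- tan = sin cos + sin² tan and sec′ = sin cos sec + sin² sec′.  These follow from
-- cos² + sin² = 1 together with tan · cos = sin and sec · cos = 1, which are exactly the
-- recurrences defining T and E, read coefficientwise.

open import Defs
open import Function using (_∘_)
open import Data.Nat as ℕ using (ℕ; zero; suc; _≤_; _<_; z≤n; s≤s; _∸_)
import Data.Nat.Properties as ℕₚ
open import Data.Nat.Combinatorics using (_C_; nCk+nC[k+1]≡[n+1]C[k+1])
open import Data.Nat.Induction using (<-rec)
open import Data.Integer as ℤ using (ℤ; +_)
import Data.Integer.Tactic.RingSolver as ℤ-Solver
open import Data.Rational using (ℚ; 0ℚ; 1ℚ; _*_; _+_; -_; _-_; _/_; toℚᵘ)
open import Data.Rational.Properties
open import Data.Rational.Unnormalised as ℚᵘ using (mkℚᵘ; *≡*)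
import Data.Rational.Unnormalised.Properties as ℚᵘₚ
open import Data.List using (List; []; _∷_)
open import Relation.Nullary.Decidable using (dec⇒maybe)
open import Data.Product using (_×_; _,_; proj₁; proj₂; ∃)
open import Data.Sum using (_⊎_; inj₁; inj₂)
open import Algebra.Bundles using (CommutativeMonoid)
open import Algebra.Properties.CommutativeSemigroup
  (CommutativeMonoid.commutativeSemigroup +-0-commutativeMonoid) using (interchange; x∙yz≈y∙xz)
open import Relation.Binary.PropositionalEquality
open import Tactic.RingSolver using (solve-∀)
import Tactic.RingSolver.Core.AlmostCommutativeRing as ACR

open ≡-Reasoning

ℚ-ring : ACR.AlmostCommutativeRing _ _
ℚ-ring = ACR.fromCommutativeRing +-*-commutativeRing (λ x → dec⇒maybe (0ℚ ≟ x))

2ℚ -4ℚ : ℚ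
2ℚ = + 2 / 1
-4ℚ = - (+ 4 / 1)

-- a : Seq stands for Σ a i xⁱ/i!; then ∂ and ∫ are differentiation and integration from 0,
-- and _⋆_ is the product (its recursion is the Leibniz rule).
Seq : Set
Seq = ℕ → ℚ

∂ ∫ : Seq → Seq
∂ a i = a (suc i)
∫ a zero = 0ℚ
∫ a (suc i) = a i

0ˢ δ exp : Seq
0ˢ _ = 0ℚ
δ zero = 1ℚ
δ (suc _) = 0ℚ
exp _ = 1ℚ

infixl 7 _⋆_ _·ˢ_
infixl 6 _+ˢ_

_+ˢ_ : Seq → Seq → Seq
(a +ˢ b) i = a i + b i

-ˢ_ : Seq → Seq
(-ˢ a) i = - a i

_·ˢ_ : ℚ → Seq → Seq
(x ·ˢ a) i = x * a i

_⋆_ : Seq → Seq → Seq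
(a ⋆ b) zero = a 0 * b 0
(a ⋆ b) (suc N) = (∂ a ⋆ b) N + (a ⋆ ∂ b) N

⋆-cong-≤ : ∀ {a a′ b b′} N → (∀ i → i ≤ N → a i ≡ a′ i) → (∀ i → i ≤ N → b i ≡ b′ i) →
           (a ⋆ b) N ≡ (a′ ⋆ b′) N
⋆-cong-≤ zero ha hb = cong₂ _*_ (ha 0 z≤n) (hb 0 z≤n)
⋆-cong-≤ (suc N) ha hb = cong₂ _+_
  (⋆-cong-≤ N (λ i i≤N → ha (suc i) (s≤s i≤N)) (λ i i≤N → hb i (ℕₚ.m≤n⇒m≤1+n i≤N)))
  (⋆-cong-≤ N (λ i i≤N → ha i (ℕₚ.m≤n⇒m≤1+n i≤N)) (λ i i≤N → hb (suc i) (s≤s i≤N)))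

⋆-cong : ∀ {a a′ b b′} → a ≗ a′ → b ≗ b′ → a ⋆ b ≗ a′ ⋆ b′
⋆-cong ha hb N = ⋆-cong-≤ N (λ i _ → ha i) (λ i _ → hb i)

⋆-comm : ∀ a b → a ⋆ b ≗ b ⋆ a
⋆-comm a b zero = *-comm (a 0) (b 0)
⋆-comm a b (suc N) =
  trans (cong₂ _+_ (⋆-comm (∂ a) b N) (⋆-comm a (∂ b) N)) (+-comm ((b ⋆ ∂ a) N) _)

⋆-distribʳ-+ : ∀ a a′ b → (a +ˢ a′) ⋆ b ≗ a ⋆ b +ˢ a′ ⋆ b
⋆-distribʳ-+ a a′ b zero = *-distribʳ-+ (b 0) (a 0) (a′ 0)
⋆-distribʳ-+ a a′ b (suc N) =
  trans (cong₂ _+_ (⋆-distribʳ-+ (∂ a) (∂ a′) b N) (⋆-distribʳ-+ a a′ (∂ b) N))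
        (interchange ((∂ a ⋆ b) N) _ _ _)

⋆-distribˡ-+ : ∀ a b b′ → a ⋆ (b +ˢ b′) ≗ a ⋆ b +ˢ a ⋆ b′
⋆-distribˡ-+ a b b′ N = begin
  (a ⋆ (b +ˢ b′)) N         ≡⟨ ⋆-comm a _ N ⟩
  ((b +ˢ b′) ⋆ a) N         ≡⟨ ⋆-distribʳ-+ b b′ a N ⟩
  (b ⋆ a) N + (b′ ⋆ a) N    ≡⟨ cong₂ _+_ (⋆-comm b a N) (⋆-comm b′ a N) ⟩
  (a ⋆ b) N + (a ⋆ b′) N    ∎

⋆-scalarˡ : ∀ x a b → (x ·ˢ a) ⋆ b ≗ x ·ˢ (a ⋆ b)
⋆-scalarˡ x a b zero = *-assoc x (a 0) (b 0)
⋆-scalarˡ x a b (suc N) =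
  trans (cong₂ _+_ (⋆-scalarˡ x (∂ a) b N) (⋆-scalarˡ x a (∂ b) N))
        (sym (*-distribˡ-+ x _ _))

⋆-negˡ : ∀ a b → (-ˢ a) ⋆ b ≗ -ˢ (a ⋆ b)
⋆-negˡ a b zero = sym (neg-distribˡ-* (a 0) (b 0))
⋆-negˡ a b (suc N) =
  trans (cong₂ _+_ (⋆-negˡ (∂ a) b N) (⋆-negˡ a (∂ b) N))
        (sym (neg-distrib-+ ((∂ a ⋆ b) N) ((a ⋆ ∂ b) N)))

⋆-negʳ : ∀ a b → a ⋆ (-ˢ b) ≗ -ˢ (a ⋆ b)
⋆-negʳ a b N = trans (⋆-comm a _ N) (trans (⋆-negˡ b a N) (cong -_ (⋆-comm b a N)))

⋆-zeroʳ : ∀ a → a ⋆ 0ˢ ≗ 0ˢ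
⋆-zeroʳ a zero = *-zeroʳ (a 0)
⋆-zeroʳ a (suc N) = trans (cong₂ _+_ (⋆-zeroʳ (∂ a) N) (⋆-zeroʳ a N)) (+-identityʳ 0ℚ)

⋆-identityʳ : ∀ a → a ⋆ δ ≗ a
⋆-identityʳ a zero = *-identityʳ (a 0)
⋆-identityʳ a (suc N) =
  trans (cong₂ _+_ (⋆-identityʳ (∂ a) N) (⋆-zeroʳ a N)) (+-identityʳ (a (suc N)))

⋆-assoc : ∀ a b c → (a ⋆ b) ⋆ c ≗ a ⋆ (b ⋆ c)
⋆-assoc a b c zero = *-assoc (a 0) (b 0) (c 0)
⋆-assoc a b c (suc N) = begin
  ((∂ a ⋆ b +ˢ a ⋆ ∂ b) ⋆ c) N + ((a ⋆ b) ⋆ ∂ c) N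
    ≡⟨ cong (_+ ((a ⋆ b) ⋆ ∂ c) N) (⋆-distribʳ-+ (∂ a ⋆ b) (a ⋆ ∂ b) c N) ⟩
  ((∂ a ⋆ b) ⋆ c) N + ((a ⋆ ∂ b) ⋆ c) N + ((a ⋆ b) ⋆ ∂ c) N
    ≡⟨ cong₂ _+_ (cong₂ _+_ (⋆-assoc (∂ a) b c N) (⋆-assoc a (∂ b) c N)) (⋆-assoc a b (∂ c) N) ⟩
  (∂ a ⋆ (b ⋆ c)) N + (a ⋆ (∂ b ⋆ c)) N + (a ⋆ (b ⋆ ∂ c)) N
    ≡⟨ +-assoc ((∂ a ⋆ (b ⋆ c)) N) _ _ ⟩
  (∂ a ⋆ (b ⋆ c)) N + ((a ⋆ (∂ b ⋆ c)) N + (a ⋆ (b ⋆ ∂ c)) N)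
    ≡⟨ cong (_+_ ((∂ a ⋆ (b ⋆ c)) N)) (sym (⋆-distribˡ-+ a (∂ b ⋆ c) (b ⋆ ∂ c) N)) ⟩
  (∂ a ⋆ (b ⋆ c)) N + (a ⋆ (∂ b ⋆ c +ˢ b ⋆ ∂ c)) N
    ∎

⋆≡pointwise⋆exp : ∀ a b N → (a ⋆ b) N ≡ ((λ i → a i * b (N ∸ i)) ⋆ exp) N
⋆≡pointwise⋆exp a b zero = sym (*-identityʳ (a 0 * b 0))
⋆≡pointwise⋆exp a b (suc N) = cong₂ _+_ (⋆≡pointwise⋆exp (∂ a) b N)
  (trans (⋆≡pointwise⋆exp a (∂ b) N)
         (⋆-cong-≤ N (λ i i≤N → cong (λ k → a i * b k) (sym (ℕₚ.+-∸-assoc 1 i≤N)))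
                     (λ _ _ → refl)))

⋆exp-second-difference : ∀ a t →
  (a ⋆ exp) (suc (suc t)) ≡ 2ℚ * (a ⋆ exp) (suc t) - (a ⋆ exp) t + (∂ (∂ a) ⋆ exp) t
⋆exp-second-difference a t = identity ((∂ (∂ a) ⋆ exp) t) ((∂ a ⋆ exp) t) ((a ⋆ exp) t)
  where
  identity : ∀ x y z → (x + y) + (y + z) ≡ 2ℚ * (y + z) - z + x
  identity = solve-∀ ℚ-ring

∑ : ℕ → Seq → ℚ
∑ zero z = 0ℚ
∑ (suc L) z = z 0 + ∑ L (∂ z)

∑-cong : ∀ L {z z′} → (∀ i → i < L → z i ≡ z′ i) → ∑ L z ≡ ∑ L z′
∑-cong zero eq = refl
∑-cong (suc L) eq = cong₂ _+_ (eq 0 (s≤s z≤n)) (∑-cong L (λ i i<L → eq (suc i) (s≤s i<L)))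

∑-+ : ∀ L z z′ → ∑ L (z +ˢ z′) ≡ ∑ L z + ∑ L z′
∑-+ zero z z′ = refl
∑-+ (suc L) z z′ = trans (cong (_+_ (z 0 + z′ 0)) (∑-+ L (∂ z) (∂ z′))) (interchange (z 0) _ _ _)

∑-0 : ∀ L → ∑ L 0ˢ ≡ 0ℚ
∑-0 zero = refl
∑-0 (suc L) = trans (cong (_+_ 0ℚ) (∑-0 L)) (+-identityˡ 0ℚ)

∑-evens : ∀ L z → (∀ j → z (suc (j ℕ.+ j)) ≡ 0ℚ) → ∑ (L ℕ.+ L) z ≡ ∑ L (λ j → z (j ℕ.+ j))
∑-evens zero z odd = refl
∑-evens (suc L) z odd = cong (_+_ (z 0)) (begin
  ∑ (L ℕ.+ suc L) (∂ z)
    ≡⟨ cong (λ M → ∑ M (∂ z)) (ℕₚ.+-suc L L) ⟩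
  z 1 + ∑ (L ℕ.+ L) (∂ (∂ z))
    ≡⟨ cong₂ _+_ (odd 0) (∑-evens L (∂ (∂ z)) odd₂) ⟩
  0ℚ + ∑ L (λ j → z (suc (suc (j ℕ.+ j))))
    ≡⟨ +-identityˡ _ ⟩
  ∑ L (λ j → z (suc (suc (j ℕ.+ j))))
    ≡⟨ ∑-cong L (λ j _ → cong (z ∘ suc) (sym (ℕₚ.+-suc j j))) ⟩
  ∑ L (λ j → z (suc j ℕ.+ suc j))
    ∎)
  where
  odd₂ : ∀ j → z (suc (suc (suc (j ℕ.+ j)))) ≡ 0ℚ
  odd₂ j = trans (cong (z ∘ suc ∘ suc) (sym (ℕₚ.+-suc j j))) (odd (suc j))

toℚᵘ-ℤ→ℚ : ∀ z → toℚᵘ (ℤ→ℚ z) ℚᵘ.≃ mkℚᵘ z 0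
toℚᵘ-ℤ→ℚ z = toℚᵘ-fromℚᵘ (mkℚᵘ z 0)

toℚᵘ-≃⇒ℤ→ℚ≡ : ∀ z {p} → mkℚᵘ z 0 ℚᵘ.≃ toℚᵘ p → ℤ→ℚ z ≡ p
toℚᵘ-≃⇒ℤ→ℚ≡ z eq = toℚᵘ-injective (ℚᵘₚ.≃-trans (toℚᵘ-ℤ→ℚ z) eq)

ℤ→ℚ-homo-+ : ∀ a b → ℤ→ℚ (a ℤ.+ b) ≡ ℤ→ℚ a + ℤ→ℚ b
ℤ→ℚ-homo-+ a b = toℚᵘ-≃⇒ℤ→ℚ≡ (a ℤ.+ b) (ℚᵘₚ.≃-trans (*≡* (identity a b)) (ℚᵘₚ.≃-sym
  (ℚᵘₚ.≃-trans (toℚᵘ-homo-+ (ℤ→ℚ a) (ℤ→ℚ b)) (ℚᵘₚ.+-cong (toℚᵘ-ℤ→ℚ a) (toℚᵘ-ℤ→ℚ b)))))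
  where
  identity : ∀ a b → (a ℤ.+ b) ℤ.* + 1 ≡ (a ℤ.* + 1 ℤ.+ b ℤ.* + 1) ℤ.* + 1
  identity = ℤ-Solver.solve-∀

ℤ→ℚ-homo-* : ∀ a b → ℤ→ℚ (a ℤ.* b) ≡ ℤ→ℚ a * ℤ→ℚ b
ℤ→ℚ-homo-* a b = toℚᵘ-≃⇒ℤ→ℚ≡ (a ℤ.* b) (ℚᵘₚ.≃-sym
  (ℚᵘₚ.≃-trans (toℚᵘ-homo-* (ℤ→ℚ a) (ℤ→ℚ b)) (ℚᵘₚ.*-cong (toℚᵘ-ℤ→ℚ a) (toℚᵘ-ℤ→ℚ b))))

ℤ→ℚ-homo‿- : ∀ a → ℤ→ℚ (ℤ.- a) ≡ - ℤ→ℚ a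
ℤ→ℚ-homo‿- a = toℚᵘ-≃⇒ℤ→ℚ≡ (ℤ.- a) (ℚᵘₚ.≃-sym
  (ℚᵘₚ.≃-trans (toℚᵘ-homo‿- (ℤ→ℚ a)) (ℚᵘₚ.-‿cong (toℚᵘ-ℤ→ℚ a))))

neg1^ℚ : ℕ → ℚ
neg1^ℚ zero = 1ℚ
neg1^ℚ (suc k) = - neg1^ℚ k

ℤ→ℚ-neg1^ : ∀ k → ℤ→ℚ (neg1^ k) ≡ neg1^ℚ k
ℤ→ℚ-neg1^ zero = refl
ℤ→ℚ-neg1^ (suc k) = trans (ℤ→ℚ-homo‿- (neg1^ k)) (cong -_ (ℤ→ℚ-neg1^ k))

_Cℚ_ : ℕ → ℕ → ℚ
N Cℚ k = ℤ→ℚ (+ (N C k))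

Cℚ-pascal : ∀ N k → suc N Cℚ suc k ≡ N Cℚ k + N Cℚ suc k
Cℚ-pascal N k = trans (cong (ℤ→ℚ ∘ +_) (sym (nCk+nC[k+1]≡[n+1]C[k+1] N k)))
                      (ℤ→ℚ-homo-+ (+ (N C k)) (+ (N C suc k)))

⋆exp-binomial : ∀ w N L → N < L → (w ⋆ exp) N ≡ ∑ L (λ i → N Cℚ i * w i)
⋆exp-binomial w zero (suc L) _ = begin
  w 0 * 1ℚ           ≡⟨ *-comm (w 0) 1ℚ ⟩
  1ℚ * w 0           ≡⟨ +-identityʳ (1ℚ * w 0) ⟨
  1ℚ * w 0 + 0ℚ      ≡⟨ cong (_+_ (1ℚ * w 0)) (∑-0 L) ⟨
  1ℚ * w 0 + ∑ L 0ˢ  ≡⟨ cong (_+_ (1ℚ * w 0)) (∑-cong L (λ i _ → *-zeroˡ (w (suc i)))) ⟨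
  1ℚ * w 0 + ∑ L (λ i → 0 Cℚ suc i * w (suc i)) ∎
⋆exp-binomial w (suc N) (suc L) (s≤s N<L) = begin
  (∂ w ⋆ exp) N + (w ⋆ exp) N
    ≡⟨ cong₂ _+_ (⋆exp-binomial (∂ w) N L N<L) (⋆exp-binomial w N (suc L) (ℕₚ.m≤n⇒m≤1+n N<L)) ⟩
  ∑ L (λ i → N Cℚ i * w (suc i)) + (1ℚ * w 0 + ∑ L (λ i → N Cℚ suc i * w (suc i)))
    ≡⟨ x∙yz≈y∙xz (∑ L (λ i → N Cℚ i * w (suc i))) (1ℚ * w 0) _ ⟩
  1ℚ * w 0 + (∑ L (λ i → N Cℚ i * w (suc i)) + ∑ L (λ i → N Cℚ suc i * w (suc i)))
    ≡⟨ cong (_+_ (1ℚ * w 0)) (∑-+ L (λ i → N Cℚ i * w (suc i)) _) ⟨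
  1ℚ * w 0 + ∑ L (λ i → N Cℚ i * w (suc i) + N Cℚ suc i * w (suc i))
    ≡⟨ cong (_+_ (1ℚ * w 0)) (∑-cong L pascal) ⟩
  1ℚ * w 0 + ∑ L (λ i → suc N Cℚ suc i * w (suc i))
    ∎
  where
  pascal : ∀ i → i < L → N Cℚ i * w (suc i) + N Cℚ suc i * w (suc i) ≡ suc N Cℚ suc i * w (suc i)
  pascal i _ = trans (sym (*-distribʳ-+ (w (suc i)) (N Cℚ i) (N Cℚ suc i)))
                     (cong (_* w (suc i)) (sym (Cℚ-pascal N i)))

⋆-binomial : ∀ a b N L → N < L → (a ⋆ b) N ≡ ∑ L (λ i → N Cℚ i * (a i * b (N ∸ i)))
⋆-binomial a b N L N<L = trans (⋆≡pointwise⋆exp a b N) (⋆exp-binomial _ N L N<L)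

x-y≡z⇒x≡z+y : ∀ {x y z} → x - y ≡ z → x ≡ z + y
x-y≡z⇒x≡z+y {x} {y} eq = trans (identity x y) (cong (_+ y) eq)
  where
  identity : ∀ x y → x ≡ (x - y) + y
  identity = solve-∀ ℚ-ring

cos sin sincos sin² : Seq
cos zero = 1ℚ
cos (suc zero) = 0ℚ
cos (suc (suc i)) = - cos i
sin zero = 0ℚ
sin (suc zero) = 1ℚ
sin (suc (suc i)) = - sin i
sincos zero = 0ℚ
sincos (suc zero) = 1ℚ
sincos (suc (suc i)) = -4ℚ * sincos i
sin² zero = 0ℚ
sin² (suc zero) = 0ℚ
sin² (suc (suc zero)) = 2ℚ
sin² (suc (suc (suc i))) = -4ℚ * sin² (suc i)

∂cos : ∂ cos ≗ -ˢ sin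
∂cos zero = refl
∂cos (suc zero) = refl
∂cos (suc (suc i)) = cong -_ (∂cos i)

∂sin : ∂ sin ≗ cos
∂sin zero = refl
∂sin (suc zero) = refl
∂sin (suc (suc i)) = cong -_ (∂sin i)

∂sin² : ∂ sin² ≗ 2ℚ ·ˢ sincos
∂sin² zero = refl
∂sin² (suc zero) = refl
∂sin² (suc (suc i)) = trans (cong (-4ℚ *_) (∂sin² i)) (identity (sincos i))
  where
  identity : ∀ x → -4ℚ * (2ℚ * x) ≡ 2ℚ * (-4ℚ * x)
  identity = solve-∀ ℚ-ring

∂sincos : ∀ i → sincos (suc i) ≡ δ i - 2ℚ * sin² i
∂sincos zero = refl
∂sincos (suc zero) = refl
∂sincos (suc (suc zero)) = refl
∂sincos (suc (suc (suc i))) =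
  trans (cong (-4ℚ *_) (∂sincos (suc i))) (identity (sin² (suc i)))
  where
  identity : ∀ x → -4ℚ * (0ℚ - 2ℚ * x) ≡ 0ℚ - 2ℚ * (-4ℚ * x)
  identity = solve-∀ ℚ-ring

cos-even : ∀ k → cos (k ℕ.+ k) ≡ neg1^ℚ k
cos-even zero = refl
cos-even (suc k) rewrite ℕₚ.+-suc k k = cong -_ (cos-even k)

cos-odd : ∀ k → cos (suc (k ℕ.+ k)) ≡ 0ℚ
cos-odd zero = refl
cos-odd (suc k) rewrite ℕₚ.+-suc k k = cong -_ (cos-odd k)

sin-even : ∀ k → sin (k ℕ.+ k) ≡ 0ℚ
sin-even zero = refl
sin-even (suc k) rewrite ℕₚ.+-suc k k = cong -_ (sin-even k)

sin-odd : ∀ k → sin (suc (k ℕ.+ k)) ≡ neg1^ℚ k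
sin-odd zero = refl
sin-odd (suc k) rewrite ℕₚ.+-suc k k = cong -_ (sin-odd k)

cos²+sin² : ∀ N → (cos ⋆ cos) N + (sin ⋆ sin) N ≡ δ N
cos²+sin² zero = refl
cos²+sin² (suc N) = begin
  ((∂ cos ⋆ cos) N + (cos ⋆ ∂ cos) N) + ((∂ sin ⋆ sin) N + (sin ⋆ ∂ sin) N)
    ≡⟨ cong₂ _+_ (cong₂ _+_ (trans (⋆-cong ∂cos (λ _ → refl) N) (⋆-negˡ sin cos N))
                            (trans (⋆-cong (λ _ → refl) ∂cos N) (⋆-negʳ cos sin N)))
                 (cong₂ _+_ (⋆-cong ∂sin (λ _ → refl) N) (⋆-cong (λ _ → refl) ∂sin N)) ⟩
  (- (sin ⋆ cos) N + - (cos ⋆ sin) N) + ((cos ⋆ sin) N + (sin ⋆ cos) N)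
    ≡⟨ identity ((sin ⋆ cos) N) ((cos ⋆ sin) N) ⟩
  0ℚ ∎
  where
  identity : ∀ x y → (- x + - y) + (y + x) ≡ 0ℚ
  identity = solve-∀ ℚ-ring

cos⋆cos≡δ-sin⋆sin : ∀ N → (cos ⋆ cos) N ≡ δ N - (sin ⋆ sin) N
cos⋆cos≡δ-sin⋆sin N =
  trans (identity ((cos ⋆ cos) N) ((sin ⋆ sin) N)) (cong (_- (sin ⋆ sin) N) (cos²+sin² N))
  where
  identity : ∀ x y → x ≡ (x + y) - y
  identity = solve-∀ ℚ-ring

sin⋆sin×sin⋆cos : ∀ N → (sin ⋆ sin) N ≡ sin² N × (sin ⋆ cos) N ≡ sincos N
sin⋆sin×sin⋆cos zero = refl , refl
sin⋆sin×sin⋆cos (suc N) with sin⋆sin×sin⋆cos N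
... | sin⋆sin , sin⋆cos = sin⋆sin′ , sin⋆cos′
  where
  sin⋆sin′ : (∂ sin ⋆ sin) N + (sin ⋆ ∂ sin) N ≡ sin² (suc N)
  sin⋆sin′ = begin
    (∂ sin ⋆ sin) N + (sin ⋆ ∂ sin) N
      ≡⟨ cong₂ _+_ (trans (⋆-cong ∂sin (λ _ → refl) N) (⋆-comm cos sin N))
                   (⋆-cong (λ _ → refl) ∂sin N) ⟩
    (sin ⋆ cos) N + (sin ⋆ cos) N  ≡⟨ cong₂ _+_ sin⋆cos sin⋆cos ⟩
    sincos N + sincos N            ≡⟨ identity (sincos N) ⟩
    2ℚ * sincos N                  ≡⟨ ∂sin² N ⟨
    sin² (suc N)                   ∎
    where
    identity : ∀ x → x + x ≡ 2ℚ * x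
    identity = solve-∀ ℚ-ring
  sin⋆cos′ : (∂ sin ⋆ cos) N + (sin ⋆ ∂ cos) N ≡ sincos (suc N)
  sin⋆cos′ = begin
    (∂ sin ⋆ cos) N + (sin ⋆ ∂ cos) N
      ≡⟨ cong₂ _+_ (⋆-cong ∂sin (λ _ → refl) N)
                   (trans (⋆-cong (λ _ → refl) ∂cos N) (⋆-negʳ sin sin N)) ⟩
    (cos ⋆ cos) N + - (sin ⋆ sin) N
      ≡⟨ cong₂ (λ x y → x + - y) (cos⋆cos≡δ-sin⋆sin N) sin⋆sin ⟩
    δ N - (sin ⋆ sin) N + - sin² N  ≡⟨ cong (λ y → δ N - y + - sin² N) sin⋆sin ⟩
    δ N - sin² N + - sin² N        ≡⟨ identity (δ N) (sin² N) ⟩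
    δ N - 2ℚ * sin² N              ≡⟨ ∂sincos N ⟨
    sincos (suc N)                 ∎
    where
    identity : ∀ x y → x - y + - y ≡ x - 2ℚ * y
    identity = solve-∀ ℚ-ring

sin⋆sin : ∀ N → (sin ⋆ sin) N ≡ sin² N
sin⋆sin N = proj₁ (sin⋆sin×sin⋆cos N)

sin⋆cos : ∀ N → (sin ⋆ cos) N ≡ sincos N
sin⋆cos N = proj₂ (sin⋆sin×sin⋆cos N)

⋆cos² : ∀ a N → (a ⋆ (cos ⋆ cos)) N ≡ a N - (a ⋆ sin²) N
⋆cos² a N = begin
  (a ⋆ (cos ⋆ cos)) N          ≡⟨ ⋆-cong (λ _ → refl) cos⋆cos N ⟩
  (a ⋆ (δ +ˢ -ˢ sin²)) N       ≡⟨ ⋆-distribˡ-+ a δ (-ˢ sin²) N ⟩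
  (a ⋆ δ) N + (a ⋆ -ˢ sin²) N  ≡⟨ cong₂ _+_ (⋆-identityʳ a N) (⋆-negʳ a sin² N) ⟩
  a N - (a ⋆ sin²) N           ∎
  where
  cos⋆cos : ∀ M → (cos ⋆ cos) M ≡ δ M - sin² M
  cos⋆cos M = trans (cos⋆cos≡δ-sin⋆sin M) (cong (_-_ (δ M)) (sin⋆sin M))

tan-identity : ∀ τ → (∀ N → (τ ⋆ cos) N ≡ sin N) → ∀ N → τ N ≡ sincos N + (sin² ⋆ τ) N
tan-identity τ τ⋆cos N = trans (x-y≡z⇒x≡z+y (begin
  τ N - (τ ⋆ sin²) N      ≡⟨ ⋆cos² τ N ⟨
  (τ ⋆ (cos ⋆ cos)) N     ≡⟨ ⋆-assoc τ cos cos N ⟨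
  ((τ ⋆ cos) ⋆ cos) N     ≡⟨ ⋆-cong τ⋆cos (λ _ → refl) N ⟩
  (sin ⋆ cos) N           ≡⟨ sin⋆cos N ⟩
  sincos N                ∎)) (cong (_+_ (sincos N)) (⋆-comm τ sin² N))

sec-identity : ∀ σ → (∀ N → (σ ⋆ cos) N ≡ δ N) → ∀ N → ∂ σ N ≡ (sincos ⋆ σ) N + (sin² ⋆ ∂ σ) N
sec-identity σ σ⋆cos N = trans (x-y≡z⇒x≡z+y (begin
  ∂ σ N - (∂ σ ⋆ sin²) N  ≡⟨ ⋆cos² (∂ σ) N ⟨
  (∂ σ ⋆ (cos ⋆ cos)) N   ≡⟨ ⋆-assoc (∂ σ) cos cos N ⟨
  ((∂ σ ⋆ cos) ⋆ cos) N   ≡⟨ ⋆-cong ∂σ⋆cos (λ _ → refl) N ⟩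
  ((σ ⋆ sin) ⋆ cos) N     ≡⟨ ⋆-assoc σ sin cos N ⟩
  (σ ⋆ (sin ⋆ cos)) N     ≡⟨ ⋆-cong (λ _ → refl) sin⋆cos N ⟩
  (σ ⋆ sincos) N          ∎))
  (cong₂ _+_ (⋆-comm σ sincos N) (⋆-comm (∂ σ) sin² N))
  where
  ∂σ⋆cos : ∀ M → (∂ σ ⋆ cos) M ≡ (σ ⋆ sin) M
  ∂σ⋆cos M = trans (x-y≡z⇒x≡z+y (begin
    (∂ σ ⋆ cos) M - (σ ⋆ sin) M       ≡⟨ cong (_+_ ((∂ σ ⋆ cos) M)) (⋆-negʳ σ sin M) ⟨
    (∂ σ ⋆ cos) M + (σ ⋆ -ˢ sin) M    ≡⟨ cong (_+_ ((∂ σ ⋆ cos) M)) (⋆-cong (λ _ → refl) ∂cos M) ⟨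
    (σ ⋆ cos) (suc M)                 ≡⟨ σ⋆cos (suc M) ⟩
    0ℚ                                ∎)) (+-identityˡ _)

-- diffTable u v n i is the forward difference Δⁱ f_n(1) of a solution of (*) with
-- u n = f_n(1) and v n = f_n(2) - f_n(1).
diffTable : Seq → Seq → ℕ → Seq
diffTable u v zero i = 0ℚ
diffTable u v (suc n) zero = u (suc n)
diffTable u v (suc n) (suc zero) = v (suc n)
diffTable u v (suc n) (suc (suc i)) = -4ℚ * diffTable u v n i

∫diffTable-closed : ∀ n (u v a b : Seq) →
  (∀ m → m ≤ n → u (suc m) ≡ a (m ℕ.+ m)) →
  (∀ m → m < n → v (suc (suc m)) ≡ 2ℚ * b (suc (m ℕ.+ m))) →
  ∀ i → i ≤ suc (n ℕ.+ n) →
  ∫ (diffTable u v (suc n)) i ≡ sincos i * a (suc (n ℕ.+ n) ∸ i) + sin² i * b (suc (n ℕ.+ n) ∸ i)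
∫diffTable-closed n u v a b hu hv zero _ = sym (identity (a _) (b _))
  where
  identity : ∀ x y → 0ℚ * x + 0ℚ * y ≡ 0ℚ
  identity = solve-∀ ℚ-ring
∫diffTable-closed n u v a b hu hv (suc zero) _ = trans (hu n ℕₚ.≤-refl) (sym (identity (a _) (b _)))
  where
  identity : ∀ x y → 1ℚ * x + 0ℚ * y ≡ x
  identity = solve-∀ ℚ-ring
∫diffTable-closed zero u v a b hu hv (suc (suc i)) (s≤s ())
∫diffTable-closed (suc m) u v a b hu hv (suc (suc zero)) _ =
  trans (hv m ℕₚ.≤-refl) (trans (cong (λ k → 2ℚ * b k) (sym (ℕₚ.+-suc m m)))
                               (sym (identity (a _) (b (m ℕ.+ suc m)))))
  where
  identity : ∀ x y → 0ℚ * x + 2ℚ * y ≡ 2ℚ * y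
  identity = solve-∀ ℚ-ring
∫diffTable-closed (suc m) u v a b hu hv (suc (suc (suc i))) i≤ = begin
  -4ℚ * ∫ (diffTable u v (suc m)) (suc i)
    ≡⟨ cong (-4ℚ *_) (∫diffTable-closed m u v a b (λ k k≤m → hu k (ℕₚ.m≤n⇒m≤1+n k≤m))
                                                  (λ k k<m → hv k (ℕₚ.m≤n⇒m≤1+n k<m)) (suc i) i≤′) ⟩
  -4ℚ * (sincos (suc i) * a (M ∸ suc i) + sin² (suc i) * b (M ∸ suc i))
    ≡⟨ identity (sincos (suc i)) (sin² (suc i)) _ _ ⟩
  sincos (3+ i) * a (M ∸ suc i) + sin² (3+ i) * b (M ∸ suc i)
    ≡⟨ cong (λ k → sincos (3+ i) * a (k ∸ suc i) + sin² (3+ i) * b (k ∸ suc i)) (ℕₚ.+-suc m m) ⟨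
  sincos (3+ i) * a (m ℕ.+ suc m ∸ suc i) + sin² (3+ i) * b (m ℕ.+ suc m ∸ suc i) ∎
  where
  M = suc (m ℕ.+ m)
  3+_ : ℕ → ℕ
  3+ j = suc (suc (suc j))
  i≤′ : suc i ≤ M
  i≤′ = subst (suc i ≤_) (ℕₚ.+-suc m m) (ℕₚ.≤-pred (ℕₚ.≤-pred i≤))
  identity : ∀ p q x y → -4ℚ * (p * x + q * y) ≡ (-4ℚ * p) * x + (-4ℚ * q) * y
  identity = solve-∀ ℚ-ring

∫diffTable⋆exp : ∀ n (u v a b : Seq) →
  (∀ m → m ≤ n → u (suc m) ≡ a (m ℕ.+ m)) →
  (∀ m → m < n → v (suc (suc m)) ≡ 2ℚ * b (suc (m ℕ.+ m))) →
  (∫ (diffTable u v (suc n)) ⋆ exp) (suc (n ℕ.+ n)) ≡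
    (sincos ⋆ a) (suc (n ℕ.+ n)) + (sin² ⋆ b) (suc (n ℕ.+ n))
∫diffTable⋆exp n u v a b hu hv = begin
  (∫ (diffTable u v (suc n)) ⋆ exp) N
    ≡⟨ ⋆-cong-≤ N (∫diffTable-closed n u v a b hu hv) (λ _ _ → refl) ⟩
  (((λ i → sincos i * a (N ∸ i)) +ˢ (λ i → sin² i * b (N ∸ i))) ⋆ exp) N
    ≡⟨ ⋆-distribʳ-+ (λ i → sincos i * a (N ∸ i)) (λ i → sin² i * b (N ∸ i)) exp N ⟩
  ((λ i → sincos i * a (N ∸ i)) ⋆ exp) N + ((λ i → sin² i * b (N ∸ i)) ⋆ exp) N
    ≡⟨ cong₂ _+_ (⋆≡pointwise⋆exp sincos a N) (⋆≡pointwise⋆exp sin² b N) ⟨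
  (sincos ⋆ a) N + (sin² ⋆ b) N ∎
  where
  N = suc (n ℕ.+ n)

module Rows (f : ℕ → ℕ → ℚ) (sys : System f) where

  u v : Seq
  u n = f n 1
  v n = f n 2 - f n 1

  γ : ℕ → Seq
  γ = diffTable u v

  recurrence : ∀ m t → t ≤ m ℕ.+ m →
    f (suc (suc m)) (suc (suc (suc t))) ≡
      2ℚ * f (suc (suc m)) (suc (suc t)) - f (suc (suc m)) (suc t) + -4ℚ * f (suc m) (suc t)
  recurrence m t t≤2m = solve-for-first (f n (suc (suc t))) (f (suc m) (suc t)) system-at-1+t
    where
    n = suc (suc m)
    2n∸3≡1+2m : 2 ℕ.* n ∸ 3 ≡ suc (m ℕ.+ m)
    2n∸3≡1+2m rewrite ℕₚ.+-identityʳ m | ℕₚ.+-suc m (suc m) | ℕₚ.+-suc m m = refl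
    system-at-1+t : ((f n (suc (suc (suc t))) - 2ℚ * f n (suc (suc t))) + f n (suc t))
                      + (+ 4 / 1) * f (suc m) (suc t) ≡ 0ℚ
    system-at-1+t = subst₂
      (λ k k′ → ((f n k - 2ℚ * f n k′) + f n (suc t)) + (+ 4 / 1) * f (suc m) (suc t) ≡ 0ℚ)
      (ℕₚ.+-comm (suc t) 2) (ℕₚ.+-comm (suc t) 1)
      (sys n (suc t) (s≤s (s≤s z≤n)) (s≤s z≤n) (subst (suc t ≤_) (sym 2n∸3≡1+2m) (s≤s t≤2m)))
    solve-for-first : ∀ {x z} y w → ((x - 2ℚ * y) + z) + (+ 4 / 1) * w ≡ 0ℚ → x ≡ 2ℚ * y - z + -4ℚ * w
    solve-for-first {x} {z} y w eq =
      trans (identity x y z w) (trans (cong (_+ (2ℚ * y - z + -4ℚ * w)) eq) (+-identityˡ _))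
      where
      identity : ∀ x y z w → x ≡ (((x - 2ℚ * y) + z) + (+ 4 / 1) * w) + (2ℚ * y - z + -4ℚ * w)
      identity = solve-∀ ℚ-ring

  -- (*) is of second order in k, so the induction on t carries two consecutive entries.
  newton-pair : ∀ m → (∀ t → t ≤ m ℕ.+ m → f (suc m) (suc t) ≡ (γ (suc m) ⋆ exp) t) →
    ∀ t → suc t ≤ suc m ℕ.+ suc m →
    f (suc (suc m)) (suc t) ≡ (γ (suc (suc m)) ⋆ exp) t ×
    f (suc (suc m)) (suc (suc t)) ≡ (γ (suc (suc m)) ⋆ exp) (suc t)
  newton-pair m previous zero _ =
    sym (*-identityʳ (f (suc (suc m)) 1)) , sym (identity (f (suc (suc m)) 2) (f (suc (suc m)) 1))
    where
    identity : ∀ x y → (x - y) * 1ℚ + y * 1ℚ ≡ x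
    identity = solve-∀ ℚ-ring
  newton-pair m previous (suc t) t≤ with newton-pair m previous t (ℕₚ.<⇒≤ t≤)
  ... | fₜ , fₜ₊₁ = fₜ₊₁ , (begin
    f n (suc (suc (suc t)))
      ≡⟨ recurrence m t t≤2m ⟩
    2ℚ * f n (suc (suc t)) - f n (suc t) + -4ℚ * f (suc m) (suc t)
      ≡⟨ cong₂ (λ x y → 2ℚ * x - y + -4ℚ * f (suc m) (suc t)) fₜ₊₁ fₜ ⟩
    2ℚ * F (suc t) - F t + -4ℚ * f (suc m) (suc t)
      ≡⟨ cong (λ x → 2ℚ * F (suc t) - F t + -4ℚ * x) (previous t t≤2m) ⟩
    2ℚ * F (suc t) - F t + -4ℚ * (γ (suc m) ⋆ exp) t
      ≡⟨ cong (_+_ (2ℚ * F (suc t) - F t)) (⋆-scalarˡ -4ℚ (γ (suc m)) exp t) ⟨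
    2ℚ * F (suc t) - F t + (∂ (∂ (γ n)) ⋆ exp) t
      ≡⟨ ⋆exp-second-difference (γ n) t ⟨
    F (suc (suc t)) ∎)
    where
    n = suc (suc m)
    F = γ n ⋆ exp
    t≤2m : t ≤ m ℕ.+ m
    t≤2m = ℕₚ.≤-pred (subst (suc t ≤_) (ℕₚ.+-suc m m) (ℕₚ.≤-pred t≤))

  newton : ∀ n t → t ≤ n ℕ.+ n → f (suc n) (suc t) ≡ (γ (suc n) ⋆ exp) t
  newton zero zero _ = sym (*-identityʳ (f 1 1))
  newton (suc m) zero _ = proj₁ (newton-pair m (newton m) zero (s≤s z≤n))
  newton (suc m) (suc t) t≤ = proj₂ (newton-pair m (newton m) t t≤)

  sumFrom1≡∫⋆exp : ∀ n K → K ≤ suc (n ℕ.+ n) → sumFrom1 K (f (suc n)) ≡ (∫ (γ (suc n)) ⋆ exp) K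
  sumFrom1≡∫⋆exp n zero _ = refl
  sumFrom1≡∫⋆exp n (suc K) K< =
    trans (cong₂ _+_ (sumFrom1≡∫⋆exp n K (ℕₚ.<⇒≤ K<)) (newton n K (ℕₚ.≤-pred K<)))
          (+-comm _ ((γ (suc n) ⋆ exp) K))

  rowSum-closed : ∀ n (a b : Seq) →
    (∀ m → m ≤ n → u (suc m) ≡ a (m ℕ.+ m)) →
    (∀ m → m < n → v (suc (suc m)) ≡ 2ℚ * b (suc (m ℕ.+ m))) →
    rowSum f (suc n) ≡ (sincos ⋆ a) (suc (n ℕ.+ n)) + (sin² ⋆ b) (suc (n ℕ.+ n))
  rowSum-closed n a b hu hv = begin
    sumFrom1 (2 ℕ.* suc n ∸ 1) (f (suc n))   ≡⟨ cong (λ K → sumFrom1 K (f (suc n))) 2[1+n]∸1≡1+2n ⟩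
    sumFrom1 N (f (suc n))                   ≡⟨ sumFrom1≡∫⋆exp n N ℕₚ.≤-refl ⟩
    (∫ (γ (suc n)) ⋆ exp) N                  ≡⟨ ∫diffTable⋆exp n u v a b hu hv ⟩
    (sincos ⋆ a) N + (sin² ⋆ b) N            ∎
    where
    N = suc (n ℕ.+ n)
    2[1+n]∸1≡1+2n : 2 ℕ.* suc n ∸ 1 ≡ N
    2[1+n]∸1≡1+2n rewrite ℕₚ.+-identityʳ n | ℕₚ.+-suc n n = refl

ev od : Seq → Seq
ev x zero = x 0
ev x (suc zero) = 0ℚ
ev x (suc (suc i)) = ev (∂ x) i
od x zero = 0ℚ
od x (suc zero) = x 0
od x (suc (suc i)) = od (∂ x) i

ev-even : ∀ x k → ev x (k ℕ.+ k) ≡ x k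
ev-even x zero = refl
ev-even x (suc k) rewrite ℕₚ.+-suc k k = ev-even (∂ x) k

ev-odd : ∀ x k → ev x (suc (k ℕ.+ k)) ≡ 0ℚ
ev-odd x zero = refl
ev-odd x (suc k) rewrite ℕₚ.+-suc k k = ev-odd (∂ x) k

od-even : ∀ x k → od x (k ℕ.+ k) ≡ 0ℚ
od-even x zero = refl
od-even x (suc k) rewrite ℕₚ.+-suc k k = od-even (∂ x) k

od-odd : ∀ x k → od x (suc (k ℕ.+ k)) ≡ x k
od-odd x zero = refl
od-odd x (suc k) rewrite ℕₚ.+-suc k k = od-odd (∂ x) k

even⊎odd : ∀ N → (∃ λ n → N ≡ n ℕ.+ n) ⊎ (∃ λ n → N ≡ suc (n ℕ.+ n))
even⊎odd zero = inj₁ (0 , refl)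
even⊎odd (suc N) with even⊎odd N
... | inj₁ (n , refl) = inj₂ (n , refl)
... | inj₂ (n , refl) = inj₁ (suc n , cong suc (sym (ℕₚ.+-suc n n)))

double∸double : ∀ n j → (n ℕ.+ n) ∸ (j ℕ.+ j) ≡ (n ∸ j) ℕ.+ (n ∸ j)
double∸double zero j = trans (ℕₚ.0∸n≡0 (j ℕ.+ j)) (sym (cong₂ ℕ._+_ (ℕₚ.0∸n≡0 j) (ℕₚ.0∸n≡0 j)))
double∸double (suc n) zero = refl
double∸double (suc n) (suc j) rewrite ℕₚ.+-suc n n | ℕₚ.+-suc j j = double∸double n j

suc-double∸double : ∀ n j → j ≤ n → suc (n ℕ.+ n) ∸ (j ℕ.+ j) ≡ suc ((n ∸ j) ℕ.+ (n ∸ j))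
suc-double∸double n zero _ = refl
suc-double∸double (suc n) (suc j) (s≤s j≤n) rewrite ℕₚ.+-suc n n | ℕₚ.+-suc j j =
  suc-double∸double n j j≤n

altTerm : ℕ → ℕ → ℚ → ℚ
altTerm N k x = N Cℚ (k ℕ.+ k) * (neg1^ℚ k * x)

altTerm-0 : ∀ N x → altTerm N 0 x ≡ x
altTerm-0 N x = trans (*-identityˡ (1ℚ * x)) (*-identityˡ x)

altTerm-zeroʳ : ∀ N k → altTerm N k 0ℚ ≡ 0ℚ
altTerm-zeroʳ N k = trans (cong (N Cℚ (k ℕ.+ k) *_) (*-zeroʳ (neg1^ℚ k))) (*-zeroʳ (N Cℚ (k ℕ.+ k)))

⋆cos≡∑altTerm : ∀ w n N → N ≤ suc (n ℕ.+ n) →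
  (w ⋆ cos) N ≡ ∑ (suc n) (λ j → altTerm N j (w (N ∸ (j ℕ.+ j))))
⋆cos≡∑altTerm w n N N≤ = begin
  (w ⋆ cos) N
    ≡⟨ ⋆-comm w cos N ⟩
  (cos ⋆ w) N
    ≡⟨ ⋆-binomial cos w N (suc n ℕ.+ suc n) N< ⟩
  ∑ (suc n ℕ.+ suc n) (λ i → N Cℚ i * (cos i * w (N ∸ i)))
    ≡⟨ ∑-evens (suc n) (λ i → N Cℚ i * (cos i * w (N ∸ i))) odd-terms ⟩
  ∑ (suc n) (λ j → N Cℚ (j ℕ.+ j) * (cos (j ℕ.+ j) * w (N ∸ (j ℕ.+ j))))
    ≡⟨ ∑-cong (suc n) (λ j _ → cong (λ c → N Cℚ (j ℕ.+ j) * (c * w (N ∸ (j ℕ.+ j)))) (cos-even j)) ⟩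
  ∑ (suc n) (λ j → altTerm N j (w (N ∸ (j ℕ.+ j)))) ∎
  where
  N< : N < suc n ℕ.+ suc n
  N< = s≤s (subst (N ≤_) (sym (ℕₚ.+-suc n n)) N≤)
  odd-terms : ∀ j → N Cℚ suc (j ℕ.+ j) * (cos (suc (j ℕ.+ j)) * w (N ∸ suc (j ℕ.+ j))) ≡ 0ℚ
  odd-terms j = trans (cong (λ c → C * (c * w (N ∸ suc (j ℕ.+ j)))) (cos-odd j))
                      (trans (cong (C *_) (*-zeroˡ (w (N ∸ suc (j ℕ.+ j))))) (*-zeroʳ C))
    where C = N Cℚ suc (j ℕ.+ j)

ℤ→ℚ-altSum-∷ : ∀ N k e es →
  ℤ→ℚ (altSum N k (e ∷ es)) ≡ - altTerm N k (ℤ→ℚ e) + ℤ→ℚ (altSum N (suc k) es)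
ℤ→ℚ-altSum-∷ N k e es = begin
  ℤ→ℚ (s ℤ.* c ℤ.* e ℤ.+ rest)
    ≡⟨ ℤ→ℚ-homo-+ (s ℤ.* c ℤ.* e) rest ⟩
  ℤ→ℚ (s ℤ.* c ℤ.* e) + ℤ→ℚ rest
    ≡⟨ cong (_+ ℤ→ℚ rest) (ℤ→ℚ-homo-* (s ℤ.* c) e) ⟩
  ℤ→ℚ (s ℤ.* c) * ℤ→ℚ e + ℤ→ℚ rest
    ≡⟨ cong (λ x → x * ℤ→ℚ e + ℤ→ℚ rest) (ℤ→ℚ-homo-* s c) ⟩
  ℤ→ℚ s * N Cℚ (2 ℕ.* k) * ℤ→ℚ e + ℤ→ℚ rest
    ≡⟨ cong₂ (λ x K → x * N Cℚ K * ℤ→ℚ e + ℤ→ℚ rest) (ℤ→ℚ-neg1^ (suc k)) 2k≡k+k ⟩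
  - neg1^ℚ k * N Cℚ (k ℕ.+ k) * ℤ→ℚ e + ℤ→ℚ rest
    ≡⟨ cong (_+ ℤ→ℚ rest) (identity (neg1^ℚ k) _ (ℤ→ℚ e)) ⟩
  - altTerm N k (ℤ→ℚ e) + ℤ→ℚ rest
    ∎
  where
  s = neg1^ (suc k)
  c = + (N C (2 ℕ.* k))
  rest = altSum N (suc k) es
  2k≡k+k : 2 ℕ.* k ≡ k ℕ.+ k
  2k≡k+k = cong (k ℕ.+_) (ℕₚ.+-identityʳ k)
  identity : ∀ s c x → - s * c * x ≡ - (c * (s * x))
  identity = solve-∀ ℚ-ring

ℤ→ℚ-altSum : (lists : ℕ → List ℤ) → lists 0 ≡ + 1 ∷ [] →
  (∀ m → lists (suc m) ≡ headℤ (lists (suc m)) ∷ lists m) →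
  ∀ N k m → ℤ→ℚ (altSum N k (lists m)) ≡
            - ∑ (suc m) (λ j → altTerm N (k ℕ.+ j) (ℤ→ℚ (headℤ (lists (m ∸ j)))))
ℤ→ℚ-altSum lists lists-0 lists-suc N k zero = begin
  ℤ→ℚ (altSum N k (lists 0))                 ≡⟨ cong (ℤ→ℚ ∘ altSum N k) lists-0 ⟩
  ℤ→ℚ (altSum N k (+ 1 ∷ []))                ≡⟨ ℤ→ℚ-altSum-∷ N k (+ 1) [] ⟩
  - altTerm N k 1ℚ + 0ℚ                      ≡⟨ +-identityʳ _ ⟩
  - altTerm N k 1ℚ                           ≡⟨ cong (λ i → - altTerm N i 1ℚ) (ℕₚ.+-identityʳ k) ⟨
  - altTerm N (k ℕ.+ 0) 1ℚ                   ≡⟨ cong -_ (+-identityʳ _) ⟨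
  - (altTerm N (k ℕ.+ 0) 1ℚ + 0ℚ)
    ≡⟨ cong (λ l → - (altTerm N (k ℕ.+ 0) (ℤ→ℚ (headℤ l)) + 0ℚ)) lists-0 ⟨
  - ∑ 1 (λ j → altTerm N (k ℕ.+ j) (ℤ→ℚ (headℤ (lists (0 ∸ j))))) ∎
ℤ→ℚ-altSum lists lists-0 lists-suc N k (suc m) = begin
  ℤ→ℚ (altSum N k (lists (suc m)))
    ≡⟨ cong (ℤ→ℚ ∘ altSum N k) (lists-suc m) ⟩
  ℤ→ℚ (altSum N k (headℤ (lists (suc m)) ∷ lists m))
    ≡⟨ ℤ→ℚ-altSum-∷ N k (headℤ (lists (suc m))) (lists m) ⟩
  - altTerm N k (X (suc m)) + ℤ→ℚ (altSum N (suc k) (lists m))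
    ≡⟨ cong₂ _+_ (cong (λ i → - altTerm N i (X (suc m))) (sym (ℕₚ.+-identityʳ k)))
                 (ℤ→ℚ-altSum lists lists-0 lists-suc N (suc k) m) ⟩
  - altTerm N (k ℕ.+ 0) (X (suc m)) + - ∑ (suc m) (λ j → altTerm N (suc k ℕ.+ j) (X (m ∸ j)))
    ≡⟨ neg-distrib-+ (altTerm N (k ℕ.+ 0) (X (suc m))) _ ⟨
  - (altTerm N (k ℕ.+ 0) (X (suc m)) + ∑ (suc m) (λ j → altTerm N (suc k ℕ.+ j) (X (m ∸ j))))
    ≡⟨ cong (λ S → - (altTerm N (k ℕ.+ 0) (X (suc m)) + S))
            (∑-cong (suc m) (λ j _ → cong (λ i → altTerm N i (X (m ∸ j))) (sym (ℕₚ.+-suc k j)))) ⟩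
  - ∑ (suc (suc m)) (λ j → altTerm N (k ℕ.+ j) (X (suc m ∸ j))) ∎
  where
  X : ℕ → ℚ
  X i = ℤ→ℚ (headℤ (lists i))

Eℚ Tℚ : ℕ → ℚ
Eℚ n = ℤ→ℚ (E n)
Tℚ n = ℤ→ℚ (T n)

secant-sum : ∀ n → ∑ (suc n) (λ j → altTerm (n ℕ.+ n) j (Eℚ (n ∸ j))) ≡ δ (n ℕ.+ n)
secant-sum zero = refl
secant-sum (suc n) = begin
  altTerm N 0 (Eℚ (suc n)) + Y  ≡⟨ cong (_+ Y) (altTerm-0 N (Eℚ (suc n))) ⟩
  Eℚ (suc n) + Y                ≡⟨ cong (_+ Y) E-recurrence ⟩
  - Y + Y                       ≡⟨ +-inverseˡ Y ⟩
  0ℚ                            ∎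
  where
  N = suc n ℕ.+ suc n
  Y = ∑ (suc n) (λ j → altTerm N (suc j) (Eℚ (n ∸ j)))
  E-recurrence : Eℚ (suc n) ≡ - Y
  E-recurrence = trans (ℤ→ℚ-altSum secants refl (λ _ → refl) (2 ℕ.* suc n) 1 n)
    (cong (λ M → - ∑ (suc n) (λ j → altTerm M (suc j) (Eℚ (n ∸ j))))
          (cong (suc n ℕ.+_) (ℕₚ.+-identityʳ (suc n))))

tangent-sum : ∀ n → ∑ (suc n) (λ j → altTerm (suc (n ℕ.+ n)) j (Tℚ (n ∸ j))) ≡ neg1^ℚ n
tangent-sum zero = refl
tangent-sum (suc n) = begin
  altTerm N 0 (Tℚ (suc n)) + Y   ≡⟨ cong (_+ Y) (altTerm-0 N (Tℚ (suc n))) ⟩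
  Tℚ (suc n) + Y                 ≡⟨ cong (_+ Y) T-recurrence ⟩
  neg1^ℚ (suc n) + - Y + Y       ≡⟨ identity (neg1^ℚ (suc n)) Y ⟩
  neg1^ℚ (suc n)                 ∎
  where
  N = suc (suc n ℕ.+ suc n)
  Y = ∑ (suc n) (λ j → altTerm N (suc j) (Tℚ (n ∸ j)))
  T-recurrence : Tℚ (suc n) ≡ neg1^ℚ (suc n) + - Y
  T-recurrence = trans (ℤ→ℚ-homo-+ (neg1^ (suc n)) _) (cong₂ _+_ (ℤ→ℚ-neg1^ (suc n))
    (trans (ℤ→ℚ-altSum tangents refl (λ _ → refl) (suc (2 ℕ.* suc n)) 1 n)
      (cong (λ M → - ∑ (suc n) (λ j → altTerm (suc M) (suc j) (Tℚ (n ∸ j))))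
            (cong (suc n ℕ.+_) (ℕₚ.+-identityʳ (suc n))))))
  identity : ∀ x y → x + - y + y ≡ x
  identity = solve-∀ ℚ-ring

sec tan : Seq
sec = ev Eℚ
tan = od Tℚ

sec⋆cos : ∀ N → (sec ⋆ cos) N ≡ δ N
sec⋆cos N with even⊎odd N
... | inj₁ (n , refl) = begin
  (sec ⋆ cos) (n ℕ.+ n)
    ≡⟨ ⋆cos≡∑altTerm sec n (n ℕ.+ n) (ℕₚ.n≤1+n _) ⟩
  ∑ (suc n) (λ j → altTerm (n ℕ.+ n) j (sec (n ℕ.+ n ∸ (j ℕ.+ j))))
    ≡⟨ ∑-cong (suc n) (λ j _ → cong (altTerm (n ℕ.+ n) j)
         (trans (cong sec (double∸double n j)) (ev-even Eℚ (n ∸ j)))) ⟩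
  ∑ (suc n) (λ j → altTerm (n ℕ.+ n) j (Eℚ (n ∸ j)))
    ≡⟨ secant-sum n ⟩
  δ (n ℕ.+ n) ∎
... | inj₂ (n , refl) = begin
  (sec ⋆ cos) (suc (n ℕ.+ n))
    ≡⟨ ⋆cos≡∑altTerm sec n (suc (n ℕ.+ n)) ℕₚ.≤-refl ⟩
  ∑ (suc n) (λ j → altTerm (suc (n ℕ.+ n)) j (sec (suc (n ℕ.+ n) ∸ (j ℕ.+ j))))
    ≡⟨ ∑-cong (suc n) (λ j j<1+n → trans (cong (altTerm (suc (n ℕ.+ n)) j)
         (trans (cong sec (suc-double∸double n j (ℕₚ.≤-pred j<1+n))) (ev-odd Eℚ (n ∸ j))))
         (altTerm-zeroʳ _ j)) ⟩
  ∑ (suc n) 0ˢ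
    ≡⟨ ∑-0 (suc n) ⟩
  0ℚ ∎

tan⋆cos : ∀ N → (tan ⋆ cos) N ≡ sin N
tan⋆cos N with even⊎odd N
... | inj₁ (n , refl) = begin
  (tan ⋆ cos) (n ℕ.+ n)
    ≡⟨ ⋆cos≡∑altTerm tan n (n ℕ.+ n) (ℕₚ.n≤1+n _) ⟩
  ∑ (suc n) (λ j → altTerm (n ℕ.+ n) j (tan (n ℕ.+ n ∸ (j ℕ.+ j))))
    ≡⟨ ∑-cong (suc n) (λ j _ → trans (cong (altTerm (n ℕ.+ n) j)
         (trans (cong tan (double∸double n j)) (od-even Tℚ (n ∸ j))))
         (altTerm-zeroʳ _ j)) ⟩
  ∑ (suc n) 0ˢ
    ≡⟨ ∑-0 (suc n) ⟩
  0ℚ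
    ≡⟨ sin-even n ⟨
  sin (n ℕ.+ n) ∎
... | inj₂ (n , refl) = begin
  (tan ⋆ cos) (suc (n ℕ.+ n))
    ≡⟨ ⋆cos≡∑altTerm tan n (suc (n ℕ.+ n)) ℕₚ.≤-refl ⟩
  ∑ (suc n) (λ j → altTerm (suc (n ℕ.+ n)) j (tan (suc (n ℕ.+ n) ∸ (j ℕ.+ j))))
    ≡⟨ ∑-cong (suc n) (λ j j<1+n → cong (altTerm (suc (n ℕ.+ n)) j)
         (trans (cong tan (suc-double∸double n j (ℕₚ.≤-pred j<1+n))) (od-odd Tℚ (n ∸ j)))) ⟩
  ∑ (suc n) (λ j → altTerm (suc (n ℕ.+ n)) j (Tℚ (n ∸ j)))
    ≡⟨ tangent-sum n ⟩
  neg1^ℚ n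
    ≡⟨ sin-odd n ⟨
  sin (suc (n ℕ.+ n)) ∎

rowSum-tangent : ∀ g → System g → g 1 1 ≡ 1ℚ → (∀ n → 2 ≤ n → g n 1 ≡ 0ℚ) →
  (∀ n → 2 ≤ n → g n 2 ≡ (+ 2 / 1) * rowSum g (n ∸ 1)) →
  ∀ n → rowSum g (suc n) ≡ Tℚ n
rowSum-tangent g sys g₁₁ g₁ g₂ = <-rec _ step
  where
  open Rows g sys
  step : ∀ n → (∀ {m} → m < n → rowSum g (suc m) ≡ Tℚ m) → rowSum g (suc n) ≡ Tℚ n
  step n ih = begin
    rowSum g (suc n)                  ≡⟨ rowSum-closed n δ tan u≡δ v≡2tan ⟩
    (sincos ⋆ δ) N + (sin² ⋆ tan) N   ≡⟨ cong (_+ (sin² ⋆ tan) N) (⋆-identityʳ sincos N) ⟩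
    sincos N + (sin² ⋆ tan) N         ≡⟨ tan-identity tan tan⋆cos N ⟨
    tan N                             ≡⟨ od-odd Tℚ n ⟩
    Tℚ n                              ∎
    where
    N = suc (n ℕ.+ n)
    u≡δ : ∀ m → m ≤ n → g (suc m) 1 ≡ δ (m ℕ.+ m)
    u≡δ zero _ = g₁₁
    u≡δ (suc m) _ = g₁ (suc (suc m)) (s≤s (s≤s z≤n))
    v≡2tan : ∀ m → m < n → g (suc (suc m)) 2 - g (suc (suc m)) 1 ≡ 2ℚ * tan (suc (m ℕ.+ m))
    v≡2tan m m<n = begin
      g (suc (suc m)) 2 - g (suc (suc m)) 1
        ≡⟨ cong₂ _-_ (g₂ (suc (suc m)) (s≤s (s≤s z≤n))) (g₁ (suc (suc m)) (s≤s (s≤s z≤n))) ⟩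
      2ℚ * rowSum g (suc m) - 0ℚ      ≡⟨ +-identityʳ _ ⟩
      2ℚ * rowSum g (suc m)           ≡⟨ cong (2ℚ *_) (trans (ih m<n) (sym (od-odd Tℚ m))) ⟩
      2ℚ * tan (suc (m ℕ.+ m))        ∎

rowSum-secant : ∀ h → System h → h 1 1 ≡ 1ℚ → (∀ n → 2 ≤ n → h n 1 ≡ rowSum h (n ∸ 1)) →
  (∀ n → 2 ≤ n → h n 2 ≡ (+ 3 / 1) * rowSum h (n ∸ 1)) →
  ∀ n → rowSum h (suc n) ≡ Eℚ (suc n)
rowSum-secant h sys h₁₁ h₁ h₂ = <-rec _ step
  where
  open Rows h sys
  step : ∀ n → (∀ {m} → m < n → rowSum h (suc m) ≡ Eℚ (suc m)) → rowSum h (suc n) ≡ Eℚ (suc n)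
  step n ih = begin
    rowSum h (suc n)                        ≡⟨ rowSum-closed n sec (∂ sec) u≡sec v≡2∂sec ⟩
    (sincos ⋆ sec) N + (sin² ⋆ ∂ sec) N     ≡⟨ sec-identity sec sec⋆cos N ⟨
    ∂ sec N                                 ≡⟨ ev-even (∂ Eℚ) n ⟩
    Eℚ (suc n)                              ∎
    where
    N = suc (n ℕ.+ n)
    u≡sec : ∀ m → m ≤ n → h (suc m) 1 ≡ sec (m ℕ.+ m)
    u≡sec zero _ = h₁₁
    u≡sec (suc m) m<n = trans (h₁ (suc (suc m)) (s≤s (s≤s z≤n)))
                              (trans (ih m<n) (sym (ev-even Eℚ (suc m))))
    v≡2∂sec : ∀ m → m < n → h (suc (suc m)) 2 - h (suc (suc m)) 1 ≡ 2ℚ * ∂ sec (suc (m ℕ.+ m))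
    v≡2∂sec m m<n = begin
      h (suc (suc m)) 2 - h (suc (suc m)) 1
        ≡⟨ cong₂ _-_ (h₂ (suc (suc m)) (s≤s (s≤s z≤n))) (h₁ (suc (suc m)) (s≤s (s≤s z≤n))) ⟩
      (+ 3 / 1) * rowSum h (suc m) - rowSum h (suc m)
        ≡⟨ identity (rowSum h (suc m)) ⟩
      2ℚ * rowSum h (suc m)
        ≡⟨ cong (2ℚ *_) (trans (ih m<n) (sym (ev-even (∂ Eℚ) m))) ⟩
      2ℚ * ∂ sec (suc (m ℕ.+ m))
        ∎
      where
      identity : ∀ x → (+ 3 / 1) * x - x ≡ 2ℚ * x
      identity = solve-∀ ℚ-ring

theorem1p1 : (g h : ℕ → ℕ → ℚ)
    → System g
    → g 1 1 ≡ 1ℚ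
    → (∀ n → 2 ≤ n → g n 1 ≡ 0ℚ)
    → (∀ n → 2 ≤ n → g n 2 ≡ (+ 2 / 1) * rowSum g (n ∸ 1))
    → System h
    → h 1 1 ≡ 1ℚ
    → (∀ n → 2 ≤ n → h n 1 ≡ rowSum h (n ∸ 1))
    → (∀ n → 2 ≤ n → h n 2 ≡ (+ 3 / 1) * rowSum h (n ∸ 1))
    → ∀ n → 1 ≤ n
    → (rowSum g n ≡ ℤ→ℚ (T (n ∸ 1))) × (rowSum h n ≡ ℤ→ℚ (E n))
theorem1p1 g h sys-g g₁₁ g₁ g₂ sys-h h₁₁ h₁ h₂ (suc n) _ =
  rowSum-tangent g sys-g g₁₁ g₁ g₂ n , rowSum-secant h sys-h h₁₁ h₁ h₂ n
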